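{- Let $\Gamma$ be a finite, connected, simple, undirected graph with at least one edge, $G$ a group, and $s_1\in Z(G)$ with $s_1^2=1_G$. For $H_1,H_2\in\mathcal H_\Gamma$, one has $H_1\sim_r H_2$ if and only if $\Psi(H_1)=\Psi(H_2)$. That is, the orbits of the action $r$ on $\mathcal H_\Gamma$ are exactly the fibers of $\Psi$.
   Context: Fix orders $V_\Gamma=\{v_1,\dots,v_n\}$, $E_\Gamma=\{e_1,\dots,e_m\}$; write $v_i\in e_j$ if $v_i$ is an endpoint of $e_j$. $\mathbb CG$ is the complex group algebra of $G$; matrices over it are multiplied as usual. A $G$-phase of $\Gamma$ is $H\in M_{n\times m}(\mathbb CG)$ with $H_{i,j}\in G$ if $v_i\in e_j$ and $H_{i,j}=0$ otherwise; $\mathcal H_\Gamma$ is their set. For $g\in G^m$, $\underline g=\mathrm{diag}(g_1,\dots,g_m)$; the action $r$ of $G^m$ on $\mathcal H_\Gamma$ is $r(g,H)=H\underline g$, and $H_1\sim_r H_2$ means $H_1=H_2\underline g$ for some $g\in G^m$. $\Psi(H)$ is the $G$-gain function on $\Gamma$ (a map on ordered pairs of adjacent vertices into $G$ with $\psi(v,u)=\psi(u,v)^{ -1}$) given by $\Psi(H)(v_i,v_j)=s_1H_{i,k}H_{j,k}^{ -1}$ where $e_k=\{v_i,v_j\}$. -}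

module Defs where

open import Level using (Level; _⊔_)
open import Data.Nat using (ℕ; _<_)
open import Data.Fin using (Fin)
open import Data.Product using (Σ; ∃; _×_; _,_; proj₁; proj₂)
open import Data.Sum using (_⊎_)
open import Data.Maybe using (Maybe; just; nothing; map; Is-just; to-witness)
open import Data.Maybe.Relation.Binary.Pointwise using (Pointwise)
open import Relation.Binary.PropositionalEquality using (_≡_; _≢_)
open import Relation.Binary.Construct.Closure.ReflexiveTransitive using (Star)
open import Relation.Nullary using (¬_)
open import Algebra.Bundles using (Group)
open import Function.Bundles using (_⇔_)

-- Edge k has endpoints
-- end₁ k and end₂ k (the order of the two is an arbitrary labelling;
-- the edge itself is the unordered pair {end₁ k , end₂ k}).

record Graph : Set where
  field
    n m  : ℕ
    end₁ : Fin m → Fin n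
    end₂ : Fin m → Fin n

  _∈ₑ_ : Fin n → Fin m → Set
  i ∈ₑ k = (i ≡ end₁ k) ⊎ (i ≡ end₂ k)

  EdgeBetween : Fin m → Fin n → Fin n → Set
  EdgeBetween k i j = (end₁ k ≡ i × end₂ k ≡ j) ⊎ (end₁ k ≡ j × end₂ k ≡ i)

  Adjacent : Fin n → Fin n → Set
  Adjacent i j = Σ (Fin m) λ k → EdgeBetween k i j

  IsLoopless : Set
  IsLoopless = ∀ k → end₁ k ≢ end₂ k

  HasNoMultiEdges : Set
  HasNoMultiEdges = ∀ k l → EdgeBetween l (end₁ k) (end₂ k) → k ≡ l

  IsSimple : Set
  IsSimple = IsLoopless × HasNoMultiEdges

  IsConnected : Set
  IsConnected = ∀ i j → Star Adjacent i j

  HasAnEdge : Set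
  HasAnEdge = 0 < m

module _ {c ℓ : Level} (G : Group c ℓ) (Γ : Graph) where
  open Group G
  open Graph Γ

  -- A G-phase: an n×m matrix with entries in CG whose (i,k) entry lies in G
  -- if v_i ∈ e_k and is 0 otherwise.  Entries are modelled in Maybe Carrier,
  -- with `nothing` playing the role of 0 ∈ CG and `just g` the element g ∈ G.
  record Phase : Set c where
    field
      entry      : Fin n → Fin m → Maybe Carrier
      inG        : ∀ i k → i ∈ₑ k → Is-just (entry i k)
      zeroOutside : ∀ i k → ¬ (i ∈ₑ k) → entry i k ≡ nothing

  open Phase public

  elem : (H : Phase) → ∀ i k → i ∈ₑ k → Carrier
  elem H i k p = to-witness (inG H i k p)

  -- H₁ ∼_r H₂ : H₁ = H₂ · diag(g₁,…,g_m) for some g ∈ G^m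
  -- (entry (i,k) of H₂·diag(g) is H₂_{i,k} g_k, and 0 where H₂_{i,k} = 0)
  _∼r_ : Phase → Phase → Set (c ⊔ ℓ)
  H₁ ∼r H₂ = ∃ λ (g : Fin m → Carrier) →
    ∀ i k → Pointwise _≈_ (entry H₁ i k) (map (λ x → x ∙ g k) (entry H₂ i k))

  GainFunction : Set c
  GainFunction = (i j : Fin n) → Adjacent i j → Carrier

  _≐_ : GainFunction → GainFunction → Set ℓ
  ψ₁ ≐ ψ₂ = ∀ i j (a : Adjacent i j) → ψ₁ i j a ≈ ψ₂ i j a

  private
    inFst : ∀ {k i j} → EdgeBetween k i j → i ∈ₑ k
    inFst (_⊎_.inj₁ (p , _)) = _⊎_.inj₁ (Relation.Binary.PropositionalEquality.sym p)
    inFst (_⊎_.inj₂ (_ , q)) = _⊎_.inj₂ (Relation.Binary.PropositionalEquality.sym q)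
    inSnd : ∀ {k i j} → EdgeBetween k i j → j ∈ₑ k
    inSnd (_⊎_.inj₁ (_ , q)) = _⊎_.inj₂ (Relation.Binary.PropositionalEquality.sym q)
    inSnd (_⊎_.inj₂ (p , _)) = _⊎_.inj₁ (Relation.Binary.PropositionalEquality.sym p)

  Ψ : (s₁ : Carrier) → Phase → GainFunction
  Ψ s₁ H i j (k , e) = (s₁ ∙ elem H i k (inFst e)) ∙ (elem H j k (inSnd e)) ⁻¹

IsCentralInvolutionOrOne : ∀ {c ℓ} (G : Group c ℓ) → Group.Carrier G → Set (c ⊔ ℓ)
IsCentralInvolutionOrOne G s = (∀ x → s ∙ x ≈ x ∙ s) × (s ∙ s ≈ ε)
  where open Group G

-- Right-multiplying column k by g_k leaves every H_{i,k} H_{j,k}⁻¹ unchanged, so Ψ is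
-- constant on r-orbits.  Conversely, if Ψ(H₁) = Ψ(H₂), cancel s₁ and take for g_k the
-- element H₂⁻¹H₁ at the first endpoint of e_k; the equality of Ψ along e_k then forces
-- the same relation at the second endpoint.  Each edge is treated on its own.
module Submission where

open import Defs
open import Level using (Level)
open import Data.Product using (_,_; proj₁)
open import Data.Sum using (inj₁; inj₂)
open import Data.Maybe using (Maybe; just; map; Is-just; to-witness)
open import Data.Maybe.Relation.Unary.Any using (just)
open import Data.Maybe.Relation.Binary.Pointwise using (Pointwise; just; nothing)
open import Data.Fin using (Fin; _≟_)
open import Relation.Binary.PropositionalEquality using (_≡_; refl)
open import Relation.Nullary using (Dec; yes; no)
open import Relation.Nullary.Decidable using (_⊎-dec_)
open import Algebra.Bundles using (Group)
open import Function.Bundles using (_⇔_; mk⇔)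

≡just-to-witness : ∀ {a} {A : Set a} {x : Maybe A} (q : Is-just x) → x ≡ just (to-witness q)
≡just-to-witness (just _) = refl

module GroupDivision {c ℓ : Level} (G : Group c ℓ) where
  open Group G
  open import Algebra.Properties.Group G
  open import Relation.Binary.Reasoning.Setoid setoid

  x∙g//y∙g≈x//y : ∀ x y g → (x ∙ g) // (y ∙ g) ≈ x // y
  x∙g//y∙g≈x//y x y g = begin
    (x ∙ g) ∙ (y ∙ g) ⁻¹       ≈⟨ ∙-congˡ (⁻¹-anti-homo-∙ y g) ⟩
    (x ∙ g) ∙ (g ⁻¹ ∙ y ⁻¹)    ≈⟨ assoc x g (g ⁻¹ ∙ y ⁻¹) ⟩
    x ∙ (g ∙ (g ⁻¹ ∙ y ⁻¹))    ≈⟨ ∙-congˡ (\\-leftDividesˡ g (y ⁻¹)) ⟩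
    x ∙ y ⁻¹                   ∎

  s∙x//y≈s∙x′//y′⇒x//y≈x′//y′ : ∀ s x y x′ y′ →
    (s ∙ x) // y ≈ (s ∙ x′) // y′ → x // y ≈ x′ // y′
  s∙x//y≈s∙x′//y′⇒x//y≈x′//y′ s x y x′ y′ eq = ∙-cancelˡ s (x // y) (x′ // y′) (begin
    s ∙ (x ∙ y ⁻¹)      ≈⟨ assoc s x (y ⁻¹) ⟨
    (s ∙ x) ∙ y ⁻¹      ≈⟨ eq ⟩
    (s ∙ x′) ∙ y′ ⁻¹    ≈⟨ assoc s x′ (y′ ⁻¹) ⟩
    s ∙ (x′ ∙ y′ ⁻¹)    ∎)

  x//y≈u//v⇒y≈v∙u\\x : ∀ x y u v → x // y ≈ u // v → y ≈ v ∙ (u \\ x)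
  x//y≈u//v⇒y≈v∙u\\x x y u v eq = begin
    y                ≈⟨ \\-leftDividesˡ v y ⟨
    v ∙ (v \\ y)     ≈⟨ ∙-congˡ (y≈x\\z u (v \\ y) x x≈u∙v\\y) ⟩
    v ∙ (u \\ x)     ∎
    where
    x≈u∙v\\y : u ∙ (v \\ y) ≈ x
    x≈u∙v\\y = begin
      u ∙ (v ⁻¹ ∙ y)   ≈⟨ assoc u (v ⁻¹) y ⟨
      (u // v) ∙ y     ≈⟨ ∙-congʳ eq ⟨
      (x // y) ∙ y     ≈⟨ //-rightDividesˡ y x ⟩
      x                ∎

module _ {c ℓ : Level} (G : Group c ℓ) (Γ : Graph) where
  open Group G renaming (refl to ≈-refl)
  open Graph Γ
  open GroupDivision G
  open import Algebra.Properties.Group G using (//-cong₂; \\-leftDividesˡ)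
  open import Relation.Binary.Reasoning.Setoid setoid

  ColumnsScaledBy : (Fin m → Carrier) → Phase G Γ → Phase G Γ → Set ℓ
  ColumnsScaledBy g H₁ H₂ = ∀ i k (p : i ∈ₑ k) → elem G Γ H₁ i k p ≈ elem G Γ H₂ i k p ∙ g k

  entry≡just-elem : ∀ H i k (p : i ∈ₑ k) → entry H i k ≡ just (elem G Γ H i k p)
  entry≡just-elem H i k p = ≡just-to-witness (inG H i k p)

  _∈ₑ?_ : ∀ i k → Dec (i ∈ₑ k)
  i ∈ₑ? k = (i ≟ end₁ k) ⊎-dec (i ≟ end₂ k)

  ∼r⇒columnsScaled : ∀ H₁ H₂ → (sim : _∼r_ G Γ H₁ H₂) → ColumnsScaledBy (proj₁ sim) H₁ H₂
  ∼r⇒columnsScaled H₁ H₂ (g , pw) i k p =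
    elem≈ (entry≡just-elem H₁ i k p) (entry≡just-elem H₂ i k p) (pw i k)
    where
    elem≈ : ∀ {x₁ x₂ a b} → x₁ ≡ just a → x₂ ≡ just b →
            Pointwise _≈_ x₁ (map (_∙ g k) x₂) → a ≈ b ∙ g k
    elem≈ refl refl (just a≈b∙g) = a≈b∙g

  columnsScaled⇒∼r : ∀ {g} H₁ H₂ → ColumnsScaledBy g H₁ H₂ → _∼r_ G Γ H₁ H₂
  columnsScaled⇒∼r {g} H₁ H₂ scaled = g , entries
    where
    entries : ∀ i k → Pointwise _≈_ (entry H₁ i k) (map (_∙ g k) (entry H₂ i k))
    entries i k with i ∈ₑ? k
    ... | yes p rewrite entry≡just-elem H₁ i k p | entry≡just-elem H₂ i k p = just (scaled i k p)
    ... | no ¬p rewrite zeroOutside H₁ i k ¬p | zeroOutside H₂ i k ¬p = nothing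

  Ψ-columnsScaled : ∀ s {g} H₁ H₂ → ColumnsScaledBy g H₁ H₂ → _≐_ G Γ (Ψ G Γ s H₁) (Ψ G Γ s H₂)
  Ψ-columnsScaled s {g} H₁ H₂ scaled i j (k , e) = begin
    (s ∙ elem G Γ H₁ i k _) // elem G Γ H₁ j k _
      ≈⟨ //-cong₂ (∙-congˡ (scaled i k _)) (scaled j k _) ⟩
    (s ∙ (elem G Γ H₂ i k _ ∙ g k)) // (elem G Γ H₂ j k _ ∙ g k)
      ≈⟨ //-cong₂ (assoc s _ (g k)) ≈-refl ⟨
    ((s ∙ elem G Γ H₂ i k _) ∙ g k) // (elem G Γ H₂ j k _ ∙ g k)
      ≈⟨ x∙g//y∙g≈x//y _ _ (g k) ⟩
    (s ∙ elem G Γ H₂ i k _) // elem G Γ H₂ j k _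
      ∎

  columnRatio : Phase G Γ → Phase G Γ → Fin m → Carrier
  columnRatio H₁ H₂ k = elem G Γ H₂ (end₁ k) k (inj₁ refl) \\ elem G Γ H₁ (end₁ k) k (inj₁ refl)

  Ψ-fibre⇒columnsScaled : ∀ s H₁ H₂ → _≐_ G Γ (Ψ G Γ s H₁) (Ψ G Γ s H₂) →
    ColumnsScaledBy (columnRatio H₁ H₂) H₁ H₂
  Ψ-fibre⇒columnsScaled s H₁ H₂ ψ≐ .(end₁ k) k (inj₁ refl) =
    sym (\\-leftDividesˡ _ _)
  Ψ-fibre⇒columnsScaled s H₁ H₂ ψ≐ .(end₂ k) k (inj₂ refl) =
    x//y≈u//v⇒y≈v∙u\\x _ _ _ _
      (s∙x//y≈s∙x′//y′⇒x//y≈x′//y′ s _ _ _ _ (ψ≐ (end₁ k) (end₂ k) (k , inj₁ (refl , refl))))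

theorem4p14 : {c ℓ : Level} (Γ : Graph) (G : Group c ℓ) (s₁ : Group.Carrier G) →
    Graph.IsSimple Γ → Graph.IsConnected Γ → Graph.HasAnEdge Γ →
    IsCentralInvolutionOrOne G s₁ →
    (H₁ H₂ : Phase G Γ) →
    _∼r_ G Γ H₁ H₂ ⇔ _≐_ G Γ (Ψ G Γ s₁ H₁) (Ψ G Γ s₁ H₂)
theorem4p14 Γ G s₁ _ _ _ _ H₁ H₂ = mk⇔
  (λ sim → Ψ-columnsScaled G Γ s₁ H₁ H₂ (∼r⇒columnsScaled G Γ H₁ H₂ sim))
  (λ ψ≐ → columnsScaled⇒∼r G Γ H₁ H₂ (Ψ-fibre⇒columnsScaled G Γ s₁ H₁ H₂ ψ≐))
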